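{- Let $U$ be a based scheme on $Y$ and $S$ a based scheme on $Z$ with basepoint $z_*$. Let $\tilde T\subseteq S$ be a closed subset, and let $i:U\to S$ be a based morphism of schemes such that $i\pi:U\to S/\!\!/\tilde T$ is an isomorphism, where $\pi:S\to S/\!\!/\tilde T$ is the natural morphism. Assume that $|t(ui)|=1$ for every $u\in U$ and $t\in\tilde T$. For $u\in U$ let $\tilde T''_u=\{t\in\tilde T:(ui)t=\{ui\}\}$. Then for each $u\in U$, $\tilde T''_u$ is normal in $\tilde T$, i.e. $\tilde T''_u\,t=t\,\tilde T''_u$ for every $t\in\tilde T$.
   Context: All schemes are association schemes on finite sets. For $p,q\in S$, $pq=\{r\in S:a_{pqr}>0\}$ (complex product), extended to subsets by unions. $\tilde T\subseteq S$ is closed if $\tilde T^*\tilde T\subseteq\tilde T$. For closed $\tilde T$: $z\tilde T=\bigcup_{t\in\tilde T}zt$ with $zt=\{z':(z,z')\in t\}$; $Z/\tilde T$ the set of cosets; $s^{\tilde T}=\{(z_1\tilde T,z_2\tilde T):(z_1',z_2')\in s$ for some $z_i'\in z_i\tilde T\}$; $S/\!\!/\tilde T=\{s^{\tilde T}\}$, a scheme on $Z/\tilde T$. A morphism of schemes $i$ from $U$ on $Y$ to $S$ on $Z$ is a map $i_Y:Y\to Z$ sending pairs in a common element of $U$ to pairs in a common element of $S$; $ui$ denotes the element of $S$ containing the images of the pairs in $u$, and $yi=yi_Y$. An isomorphism is a morphism bijective on points and on relations. Based: basepoints preserved; the quotient is based at the coset of the basepoint. Also $T$ (a based scheme on $X$)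 with a based isomorphism to the subscheme of $S$ defined by $z_*\tilde T$ is part of the paper's standing setting but plays no role in this statement. -}

module Defs where

open import Data.Nat using (ℕ; zero; suc; _+_)
open import Data.Fin using (Fin; zero; suc; _≟_)
open import Data.Bool using (Bool; true; false; if_then_else_)
open import Data.Product using (Σ; ∃; ∃-syntax; _×_; _,_)
open import Relation.Binary.PropositionalEquality using (_≡_)
open import Relation.Nullary.Decidable using (⌊_⌋)
open import Function.Bundles using (_⇔_)

count : ∀ {n} → (Fin n → Bool) → ℕ
count {zero}  f = 0
count {suc n} f = (if f zero then 1 else 0) + count (λ i → f (suc i))

-- An association scheme on the finite point set Fin pts with relation set
-- Fin nrel.  'rel x y' is the unique relation containing the pair (x , y).
record Scheme : Set where
  field
    pts  : ℕ
    nrel : ℕ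
    rel  : Fin pts → Fin pts → Fin nrel
    one      : Fin nrel
    rel-refl : ∀ x → rel x x ≡ one
    rel-one  : ∀ x y → rel x y ≡ one → x ≡ y
    nonempty : ∀ (s : Fin nrel) → ∃[ x ] ∃[ y ] (rel x y ≡ s)
    star     : Fin nrel → Fin nrel
    rel-star : ∀ x y → rel y x ≡ star (rel x y)
    -- intersection numbers a_{pqr} are well defined
    regular  : ∀ (p q : Fin nrel) (x y x' y' : Fin pts) → rel x y ≡ rel x' y' →
               count (λ z → ⌊ rel x z ≟ p ⌋ Data.Bool.∧ ⌊ rel z y ≟ q ⌋)
               ≡ count (λ z → ⌊ rel x' z ≟ p ⌋ Data.Bool.∧ ⌊ rel z y' ≟ q ⌋)

record BasedScheme : Set where
  field
    scheme : Scheme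
  open Scheme scheme public
  field
    base : Fin pts

module _ (S : Scheme) where
  open Scheme S

  Rel = Fin nrel
  Pt  = Fin pts

  RSet : Set₁
  RSet = Rel → Set

  -- r ∈ p q  iff  a_{pqr} > 0, i.e. some (hence every) pair (x,y) ∈ r has a
  -- z with (x,z) ∈ p and (z,y) ∈ q
  _∈prod_·_ : Rel → Rel → Rel → Set
  r ∈prod p · q = ∃[ x ] ∃[ y ] ∃[ z ] (rel x y ≡ r × rel x z ≡ p × rel z y ≡ q)

  _∈setprod_·_ : Rel → RSet → Rel → Set
  r ∈setprod A · q = ∃[ a ] (A a × r ∈prod a · q)

  _∈prod_·set_ : Rel → Rel → RSet → Set
  r ∈prod p ·set A = ∃[ a ] (A a × r ∈prod p · a)

  Closed : RSet → Set
  Closed T = ∀ t₁ t₂ r → T t₁ → T t₂ → r ∈prod star t₁ · t₂ → T r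

  _∈coset_·_ : Pt → Pt → RSet → Set
  w ∈coset z · T = T (rel z w)

  CosetEq : RSet → Pt → Pt → Set
  CosetEq T z₁ z₂ = ∀ w → (w ∈coset z₁ · T) ⇔ (w ∈coset z₂ · T)

  InQuot : RSet → Rel → Pt → Pt → Set
  InQuot T s z₁ z₂ = ∃[ z₁' ] ∃[ z₂' ]
    (z₁' ∈coset z₁ · T × z₂' ∈coset z₂ · T × rel z₁' z₂' ≡ s)

  QuotEq : RSet → Rel → Rel → Set
  QuotEq T s s' = ∀ z₁ z₂ → InQuot T s z₁ z₂ ⇔ InQuot T s' z₁ z₂

record Morphism (U S : Scheme) : Set where
  private
    module U = Scheme U
    module S = Scheme S
  field
    onPt  : Fin U.pts → Fin S.pts
    onRel : Fin U.nrel → Fin S.nrel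
    compat : ∀ y₁ y₂ → S.rel (onPt y₁) (onPt y₂) ≡ onRel (U.rel y₁ y₂)

module Submission where

-- Write v = u i and let a ∈ T''_u, t ∈ T and r ∈ a t; we find b ∈ T''_u with r ∈ t b.
-- Fix (c , y) ∈ r with c in the image of i, factor it as c -a→ w -t→ y, and let
-- o -v→ y.  Since i π is bijective, the coset of o contains an image point o₂, and
-- injectivity of i π on relations gives (o₂ , c) ∈ v, whence (o₂ , w) ∈ v a = {v}.
-- Now |t' v| = 1 for t' = rel o o₂ ∈ T forces rel o w = rel o c, so the path
-- o -v→ y -t*→ w can be moved to o -v→ z -t*→ c; then b = rel z y lies in T and
-- v ∈ v b, which by |v b| = 1 means b ∈ T''_u.  The other inclusion is the
-- transpose of this one, since T''_u is closed under transposition.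

open import Defs
open import Data.Bool as Bool using (Bool; true; false)
open import Data.Bool.Properties using (T-∧)
open import Data.Fin using (Fin; zero; suc; _≟_)
open import Data.Nat using (suc)
open import Data.Product using (∃; ∃-syntax; _×_; _,_; proj₂)
open import Function.Base using (id)
open import Function.Bundles using (_⇔_; mk⇔; Equivalence)
open import Relation.Binary.PropositionalEquality
  using (_≡_; refl; sym; trans; cong; subst; module ≡-Reasoning)
open import Relation.Nullary.Decidable using (⌊_⌋; toWitness; fromWitness)

open Equivalence using (to; from)

true⇒count-suc : ∀ {n} (f : Fin n → Bool) i → Bool.T (f i) → ∃[ k ] count f ≡ suc k
true⇒count-suc f zero    fi with f zero
... | true = _ , refl
true⇒count-suc f (suc i) fi with f zero | true⇒count-suc (λ j → f (suc j)) i fi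
... | true  | _   = _ , refl
... | false | k,e = k,e

count-suc⇒true : ∀ {n} (f : Fin n → Bool) {k} → count f ≡ suc k → ∃[ i ] Bool.T (f i)
count-suc⇒true {suc n} f e with f zero in f0
... | true  = zero , subst Bool.T (sym f0) _
... | false = let (i , fi) = count-suc⇒true (λ j → f (suc j)) e in suc i , fi

count-≡⇒∃-true : ∀ {n} (f g : Fin n → Bool) → count f ≡ count g →
                 ∀ i → Bool.T (f i) → ∃[ j ] Bool.T (g j)
count-≡⇒∃-true f g f≡g i fi =
  let (_ , e) = true⇒count-suc f i fi in count-suc⇒true g (trans (sym f≡g) e)

module SchemeProperties (S : Scheme) where
  open Scheme S

  infix 4 _∈_·_
  _∈_·_ : Rel S → Rel S → Rel S → Set
  r ∈ p · q = _∈prod_·_ S r p q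

  SingletonProduct : Rel S → Rel S → Rel S → Set
  SingletonProduct p q e = ∀ r → r ∈ p · q ⇔ r ≡ e

  RightStabilizer : RSet S → Rel S → RSet S
  RightStabilizer T v b = T b × SingletonProduct v b v

  ∈prod-factor : ∀ {r p q} → r ∈ p · q → ∀ x y → rel x y ≡ r →
                 ∃[ z ] (rel x z ≡ p × rel z y ≡ q)
  ∈prod-factor {r} {p} {q} (x₀ , y₀ , z₀ , x₀y₀ , x₀z₀ , z₀y₀) x y xy =
    let (z , pq) = count-≡⇒∃-true _ _ (regular p q x₀ y₀ x y (trans x₀y₀ (sym xy))) z₀
                     (from T-∧ (fromWitness {a? = rel x₀ z₀ ≟ p} x₀z₀ ,
                                fromWitness {a? = rel z₀ y₀ ≟ q} z₀y₀))
        (xz , zy) = to (T-∧ {⌊ rel x z ≟ p ⌋}) pq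
    in z , toWitness xz , toWitness zy

  rel-swap : ∀ {x y s} → rel x y ≡ s → rel y x ≡ star s
  rel-swap {x} {y} xy = trans (rel-star x y) (cong star xy)

  star-involutive : ∀ s → star (star s) ≡ s
  star-involutive s =
    let (x , y , xy) = nonempty s in trans (sym (rel-swap (rel-swap xy))) xy

  ∃-rel-from : ∀ p x → ∃[ y ] rel x y ≡ p
  ∃-rel-from p x =
    let (x₀ , y₀ , x₀y₀) = nonempty p
        (y , xy , _) = ∈prod-factor (x₀ , x₀ , y₀ , rel-refl x₀ , x₀y₀ , rel-swap x₀y₀)
                                    x x (rel-refl x)
    in y , xy

  ∃-rel-to : ∀ p y → ∃[ x ] rel x y ≡ p
  ∃-rel-to p y =
    let (x , yx) = ∃-rel-from (star p) y in x , trans (rel-swap yx) (star-involutive p)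

  ∈prod-star : ∀ {r p q} → r ∈ p · q → star r ∈ star q · star p
  ∈prod-star (x , y , z , xy , xz , zy) = y , x , z , rel-swap xy , rel-swap zy , rel-swap xz

  ∈prod-unstar : ∀ {r p q} → star r ∈ star q · star p → r ∈ p · q
  ∈prod-unstar {r} {p} {q} h = unstar (∈prod-star h)
    where
    unstar : star (star r) ∈ star (star p) · star (star q) → r ∈ p · q
    unstar rewrite star-involutive r | star-involutive p | star-involutive q = id

  SingletonProduct-rebase : ∀ {p q e r} → SingletonProduct p q e → r ∈ p · q →
                            SingletonProduct p q r
  SingletonProduct-rebase pq≡e r∈pq r' =
    let r≡e = to (pq≡e _) r∈pq
    in mk⇔ (λ h → trans (to (pq≡e r') h) (sym r≡e)) (λ r'≡r → from (pq≡e r') (trans r'≡r r≡e))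

  SingletonProduct-star : ∀ {p q e} → SingletonProduct (star q) (star p) e →
                          SingletonProduct p q (star e)
  SingletonProduct-star {p} {q} {e} q*p*≡e r =
    mk⇔ (λ h → trans (sym (star-involutive r)) (cong star (to (q*p*≡e (star r)) (∈prod-star h))))
        (λ r≡e* → ∈prod-unstar (subst (λ s → s ∈ star q · star p)
                                  (trans (sym (star-involutive e)) (cong star (sym r≡e*)))
                                  (from (q*p*≡e e) refl)))

module ClosedProperties (S : Scheme) (T : RSet S) (closed : Closed S T) where
  open Scheme S
  open SchemeProperties S

  T-one : ∀ {t} → T t → T one
  T-one {t} Tt =
    let (x , y , xy) = nonempty t
    in closed t t one Tt Tt (y , y , x , rel-refl y , rel-swap xy , xy)

  T-star : ∀ {t} → T t → T (star t)
  T-star {t} Tt =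
    let (x , y , xy) = nonempty t
    in closed t one (star t) Tt (T-one Tt) (y , x , x , rel-swap xy , rel-swap xy , rel-refl x)

  T-∈prod : ∀ {r a t} → T a → T t → r ∈ a · t → T r
  T-∈prod {r} {a} {t} Ta Tt r∈at =
    closed (star a) t r (T-star Ta) Tt (subst (λ s → r ∈ s · t) (sym (star-involutive a)) r∈at)

  T-rel-refl : ∀ {t} x → T t → T (rel x x)
  T-rel-refl x Tt = subst T (sym (rel-refl x)) (T-one Tt)

  T-rel-sym : ∀ {x y} → T (rel x y) → T (rel y x)
  T-rel-sym {x} {y} Txy = subst T (sym (rel-star x y)) (T-star Txy)

  T-rel-trans : ∀ {x y z} → T (rel x y) → T (rel y z) → T (rel x z)
  T-rel-trans {x} {y} {z} Txy Tyz = T-∈prod Txy Tyz (x , z , y , refl , refl , refl)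

  InQuot-transport : ∀ {s₁ s₂ p q p' q'} → rel p q ≡ s₁ → rel p' q' ≡ s₂ →
                     T (rel p p') → T (rel q q') →
                     ∀ z₁ z₂ → InQuot S T s₁ z₁ z₂ → InQuot S T s₂ z₁ z₂
  InQuot-transport {p = p} {q} {p'} {q'} pq p'q' Tpp' Tqq' z₁ z₂ (z₁' , z₂' , Tz₁ , Tz₂ , z₁'z₂') =
    let (m , z₁'m , mz₂') = ∈prod-factor (p , q , p' , pq , refl , refl) z₁' z₂' z₁'z₂'
        (m' , mm' , m'z₂') = ∈prod-factor (p' , q , q' , refl , p'q' , refl) m z₂' mz₂'
    in m , m' , T-rel-trans Tz₁ (subst T (sym z₁'m) Tpp')
              , T-rel-trans Tz₂ (T-rel-sym (subst T (sym m'z₂') (T-rel-sym Tqq')))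
              , mm'

  QuotEq-of-T-related : ∀ {s₁ s₂ p q p' q'} → rel p q ≡ s₁ → rel p' q' ≡ s₂ →
                        T (rel p p') → T (rel q q') → QuotEq S T s₁ s₂
  QuotEq-of-T-related pq p'q' Tpp' Tqq' z₁ z₂ =
    mk⇔ (InQuot-transport pq p'q' Tpp' Tqq' z₁ z₂)
        (InQuot-transport p'q' pq (T-rel-sym Tpp') (T-rel-sym Tqq') z₁ z₂)

module MorphismProperties {U S : Scheme} (i : Morphism U S) where
  open Morphism i
  private
    module U = Scheme U
    module S = Scheme S

  onRel-star : ∀ w → S.star (onRel w) ≡ onRel (U.star w)
  onRel-star w =
    let (y₁ , y₂ , y₁y₂) = U.nonempty w
        open ≡-Reasoning
    in begin
      S.star (onRel w)                   ≡⟨ cong (λ s → S.star (onRel s)) (sym y₁y₂) ⟩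
      S.star (onRel (U.rel y₁ y₂))       ≡⟨ cong S.star (sym (compat y₁ y₂)) ⟩
      S.star (S.rel (onPt y₁) (onPt y₂)) ≡⟨ sym (S.rel-star (onPt y₁) (onPt y₂)) ⟩
      S.rel (onPt y₂) (onPt y₁)          ≡⟨ compat y₂ y₁ ⟩
      onRel (U.rel y₂ y₁)                ≡⟨ cong onRel (SchemeProperties.rel-swap U y₁y₂) ⟩
      onRel (U.star w)                   ∎

module Normality {U S : Scheme} (T : RSet S) (closed : Closed S T) (i : Morphism U S)
  (onRel-injective : ∀ u₁ u₂ → QuotEq S T (Morphism.onRel i u₁) (Morphism.onRel i u₂) → u₁ ≡ u₂)
  (onPt-surjective : ∀ z → ∃[ y ] CosetEq S T (Morphism.onPt i y) z)
  (left-thin : ∀ u t → T t → ∃[ e ] SchemeProperties.SingletonProduct S t (Morphism.onRel i u) e)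
  where
  open Morphism i
  open Scheme S
  open SchemeProperties S
  open ClosedProperties S T closed
  open MorphismProperties i

  right-thin : ∀ u b → T b → ∃[ e ] SingletonProduct (onRel u) b e
  right-thin u b Tb =
    let (e , thin) = left-thin (Scheme.star U u) (star b) (T-star Tb)
    in star e , SingletonProduct-star
                  (subst (λ s → SingletonProduct (star b) s e) (sym (onRel-star u)) thin)

  T-near-image : ∀ {t} → T t → ∀ z → ∃[ y ] T (rel (onPt y) z)
  T-near-image Tt z = let (y , y≈z) = onPt-surjective z in y , from (y≈z z) (T-rel-refl z Tt)

  rel-onPt-of-T-related : ∀ {u y₁ y₂ z₁ z₂} → rel z₁ z₂ ≡ onRel u →
                          T (rel (onPt y₁) z₁) → T (rel (onPt y₂) z₂) →
                          rel (onPt y₁) (onPt y₂) ≡ onRel u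
  rel-onPt-of-T-related {y₁ = y₁} {y₂} z₁z₂ T₁ T₂ =
    trans (compat y₁ y₂) (cong onRel (onRel-injective _ _ (QuotEq-of-T-related (compat y₁ y₂) z₁z₂ T₁ T₂)))

  module Stabilizer (y₀ : Fin (Scheme.pts U)) (u : Rel U) where
    v : Rel S
    v = onRel u

    Stab : RSet S
    Stab = RightStabilizer T v

    Stab-intro : ∀ {b} → T b → v ∈ v · b → Stab b
    Stab-intro {b} Tb v∈vb = Tb , SingletonProduct-rebase (proj₂ (right-thin u b Tb)) v∈vb

    Stab-star : ∀ {a} → Stab a → Stab (star a)
    Stab-star {a} (Ta , va≡v) =
      let (x , y , z , xy , xz , zy) = from (va≡v v) refl
      in Stab-intro (T-star Ta) (x , z , y , xz , xy , rel-swap zy)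

    Stab-·-⊆-·-Stab : ∀ {t r} → T t → _∈setprod_·_ S r Stab t → _∈prod_·set_ S r t Stab
    Stab-·-⊆-·-Stab {t} {r} Tt (a , (Ta , va≡v) , r∈at) =
      let c = onPt y₀
          Tr = T-∈prod Ta Tt r∈at
          (y , cy) = ∃-rel-from r c
          Tcy = subst T (sym cy) Tr
          (w , cw , wy) = ∈prod-factor r∈at c y cy
          (o , oy) = ∃-rel-to v y
          (y₂ , To₂o) = T-near-image Tt o
          o₂ = onPt y₂
          o₂c = rel-onPt-of-T-related oy To₂o Tcy
          o₂w = to (va≡v (rel o₂ w)) (o₂ , w , c , refl , o₂c , cw)
          (_ , thin) = left-thin u (rel o o₂) (T-rel-sym To₂o)
          oc≡ow = trans (to (thin _) (o , c , o₂ , refl , refl , o₂c))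
                        (sym (to (thin _) (o , w , o₂ , refl , refl , o₂w)))
          (z , oz , zc) = ∈prod-factor (o , w , y , refl , oy , rel-swap wy) o c oc≡ow
          Tzy = T-rel-trans (subst T (sym zc) (T-star Tt)) Tcy
      in rel z y , Stab-intro Tzy (o , y , z , oy , oz , refl)
                 , (c , y , z , cy , trans (rel-swap zc) (star-involutive t) , refl)

    ·-Stab-⊆-Stab-· : ∀ {t r} → T t → _∈prod_·set_ S r t Stab → _∈setprod_·_ S r Stab t
    ·-Stab-⊆-Stab-· {t} {r} Tt (b , Sb , r∈tb) =
      let (b' , Sb' , r*∈t*b') = Stab-·-⊆-·-Stab (T-star Tt) (star b , Stab-star Sb , ∈prod-star r∈tb)
      in star b' , Stab-star Sb'
         , ∈prod-unstar (subst (λ s → star r ∈ star t · s) (sym (star-involutive b')) r*∈t*b')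

proposition7p10 :
    (U S : BasedScheme) →
    let module U = BasedScheme U
        module S = BasedScheme S
    in (T : Rel S.scheme → Set) → Closed S.scheme T →
       (i : Morphism U.scheme S.scheme) →
       -- i is based
       Morphism.onPt i U.base ≡ S.base →
       -- i π : U → S//T is bijective on points
       (∀ y₁ y₂ → CosetEq S.scheme T (Morphism.onPt i y₁) (Morphism.onPt i y₂) → y₁ ≡ y₂) →
       (∀ z → ∃[ y ] CosetEq S.scheme T (Morphism.onPt i y) z) →
       -- i π is bijective on relations
       (∀ u₁ u₂ → QuotEq S.scheme T (Morphism.onRel i u₁) (Morphism.onRel i u₂) → u₁ ≡ u₂) →
       (∀ s → ∃[ u ] QuotEq S.scheme T (Morphism.onRel i u) s) →
       -- |t (u i)| = 1 for all u ∈ U, t ∈ T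
       (∀ u t → T t → ∃[ r ] (∀ r' → _∈prod_·_ S.scheme r' t (Morphism.onRel i u) ⇔ (r' ≡ r))) →
       -- conclusion: T''_u t = t T''_u for all u and t ∈ T,
       -- where T''_u = { t ∈ T : (u i) t = {u i} }
       ∀ u t → T t →
       let T'' : Rel S.scheme → Set
           T'' t' = T t' × (∀ r → _∈prod_·_ S.scheme r (Morphism.onRel i u) t' ⇔ (r ≡ Morphism.onRel i u))
       in ∀ r → _∈setprod_·_ S.scheme r T'' t ⇔ _∈prod_·set_ S.scheme r t T''
proposition7p10 U S T closed i _ _ onPt-surjective onRel-injective _ left-thin u t Tt r =
  mk⇔ (Stab-·-⊆-·-Stab Tt) (·-Stab-⊆-Stab-· Tt)
  where
  open Normality T closed i onRel-injective onPt-surjective left-thin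
  open Stabilizer (BasedScheme.base U) u
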